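{- For every $(n,2)$-cactus $Q$, $\overrightarrow{rvc}(Q)=n-2$ and $\overrightarrow{trc}(Q)=2n-3$.
   Context: A cactus is a strongly connected oriented graph (finite, no loops, no multiple arcs, no pair of opposite arcs) in which every arc belongs to exactly one directed cycle; an $(n,q)$-cactus is a cactus with $n$ vertices and $q$ blocks (directed cycles). $\overrightarrow{rvc}(D)$ is the minimum number of colours in a vertex-colouring such that every ordered pair $(x,y)$ is joined by a directed path whose internal vertices have distinct colours. $\overrightarrow{trc}(D)$ is the minimum number of colours in a total-colouring (of vertices and arcs) such that every ordered pair is joined by a directed path whose arcs and internal vertices all receive pairwise distinct colours. -}

module Defs where

open import Data.Nat using (ℕ; _≤_; _<_)
open import Data.Fin using (Fin)
open import Data.Bool using (Bool; true; false; T)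
open import Data.List using (List; []; _∷_; _++_; map; length)
open import Data.List.Relation.Unary.All using (All)
open import Data.List.Relation.Unary.Unique.Propositional using (Unique)
open import Data.List.Membership.Propositional using (_∈_)
open import Data.Product using (Σ; _×_; _,_; uncurry)
open import Relation.Binary.PropositionalEquality using (_≡_; _≢_)
open import Relation.Nullary using (¬_)
open import Function.Bundles using (_⇔_)

Digraph : ℕ → Set
Digraph n = Fin n → Fin n → Bool

module _ {n : ℕ} (G : Digraph n) where

  Arc : Fin n → Fin n → Set
  Arc u v = T (G u v)

consecutive : {A : Set} → List A → List (A × A)
consecutive (x ∷ y ∷ xs) = (x , y) ∷ consecutive (y ∷ xs)
consecutive _ = []

module _ {n : ℕ} (G : Digraph n) where

  IsWalk : List (Fin n) → Set
  IsWalk vs = All (λ p → Arc G (Data.Product.proj₁ p) (Data.Product.proj₂ p)) (consecutive vs)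

  Oriented : Set
  Oriented = (∀ u → G u u ≡ false) × (∀ u v → Arc G u v → G v u ≡ false)

  record Path (x y : Fin n) : Set where
    field
      internal : List (Fin n)
      walk     : IsWalk (x ∷ internal ++ y ∷ [])
      distinct : Unique (x ∷ internal ++ y ∷ [])

  pathVertices : ∀ {x y} → Path x y → List (Fin n)
  pathVertices {x} {y} P = x ∷ Path.internal P ++ y ∷ []

  pathArcs : ∀ {x y} → Path x y → List (Fin n × Fin n)
  pathArcs P = consecutive (pathVertices P)

  StronglyConnected : Set
  StronglyConnected = ∀ x y → x ≢ y → Path x y

  record Cycle : Set where
    field
      start    : Fin n
      rest     : List (Fin n)
      nontriv  : 1 ≤ length rest
      distinct : Unique (start ∷ rest)
      closed   : IsWalk (start ∷ rest ++ start ∷ [])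

  cycleArcs : Cycle → List (Fin n × Fin n)
  cycleArcs C = consecutive (Cycle.start C ∷ Cycle.rest C ++ Cycle.start C ∷ [])

  InCycle : Cycle → Fin n → Fin n → Set
  InCycle C u v = (u , v) ∈ cycleArcs C

  -- two cycles are the same subgraph iff they have the same arc set
  SameCycle : Cycle → Cycle → Set
  SameCycle C D = ∀ u v → InCycle C u v ⇔ InCycle D u v

  IsCactus : Set
  IsCactus = Oriented × StronglyConnected ×
    (∀ u v → Arc G u v →
       Σ Cycle (λ C → InCycle C u v) ×
       (∀ C D → InCycle C u v → InCycle D u v → SameCycle C D))

  -- the graph has exactly q blocks (directed cycles, up to equality as subgraphs)
  HasBlocks : ℕ → Set
  HasBlocks q = Σ (Fin q → Cycle) λ cs →
    (∀ i j → SameCycle (cs i) (cs j) → i ≡ j) × (∀ C → Σ (Fin q) λ i → SameCycle C (cs i))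

  RVColouring : ℕ → Set
  RVColouring k = Σ (Fin n → Fin k) λ c →
    ∀ x y → x ≢ y → Σ (Path x y) λ P → Unique (map c (Path.internal P))

  TRColouring : ℕ → Set
  TRColouring k = Σ (Fin n → Fin k) λ cv → Σ (Fin n → Fin n → Fin k) λ ca →
    ∀ x y → x ≢ y → Σ (Path x y) λ P →
      Unique (map (uncurry ca) (pathArcs P) ++ map cv (Path.internal P))

  RVCis : ℕ → Set
  RVCis k = RVColouring k × (∀ j → j < k → ¬ RVColouring j)

  TRCis : ℕ → Set
  TRCis k = TRColouring k × (∀ j → j < k → ¬ TRColouring j)

module Submission where

-- A cactus with two blocks is a bouquet: two directed cycles v → U → v and v → W → v meeting
-- only in v. They meet because the graph is strongly connected, and a second common vertex
-- would splice a third directed cycle out of arcs of both blocks. Let u₁, w₁ be the first and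
-- u′, w′ the last vertices of U and W. Since u₁, w₁ are entered only from v and u′, w′ are left
-- only towards v, no path has both u₁ and w₁ as internal vertices, nor both u′ and w′ as
-- non-final vertices; so identifying the colours of u₁, w₁ and of u′, w′ gives a rainbow vertex
-- colouring with n − 2 colours, and colouring every arc by its tail, with u′ and w′ identified,
-- adds n − 1 further colours for a total rainbow colouring. Conversely the path from u₁ to w′
-- is forced through all n vertices, so its n − 2 internal vertices and n − 1 arcs need pairwise
-- distinct colours.

open import Defs
open import Data.Bool using (T)
open import Data.Nat using (ℕ; zero; suc; _+_; _∸_; _*_; _≤_; z≤n; s≤s; s≤s⁻¹)
open import Data.Nat.Properties using (+-suc; +-comm; +-identityʳ; ≤-trans; +-mono-≤; <⇒≱; module ≤-Reasoning)
open import Data.Fin using (Fin; zero; suc; _≟_; punchOut; _↑ˡ_; _↑ʳ_; splitAt)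
open import Data.Fin.Properties using (punchOut-injective; splitAt-↑ˡ; splitAt-↑ʳ; ↑ˡ-injective; ↑ʳ-injective)
open import Data.List using (List; []; _∷_; _++_; map; length)
open import Data.List.Properties using (length-++; ++-assoc; length-map; length-tabulate)
open import Data.List.Relation.Unary.All as All using (All; []; _∷_)
import Data.List.Relation.Unary.All.Properties as All
open import Data.List.Relation.Unary.AllPairs using ([]; _∷_)
open import Data.List.Relation.Unary.Any using (Any; here; there; any?)
open import Data.List.Relation.Unary.Unique.Propositional using (Unique)
open import Data.List.Relation.Unary.Unique.Propositional.Properties using (allFin⁺; ++⁺; map⁻; Unique[x∷xs]⇒x∉xs)
open import Data.List.Relation.Binary.Disjoint.Propositional using (Disjoint)
open import Data.List.Relation.Binary.Subset.Propositional using (_⊆_)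
open import Data.List.Relation.Binary.Subset.Propositional.Properties using (⊆-reflexive-↭)
open import Data.List.Relation.Binary.Permutation.Propositional.Properties using (++-comm)
open import Data.List.Membership.Propositional using (_∈_; _∉_; find; lose)
import Data.List.Membership.DecPropositional as DecMembership
open import Data.List.Membership.Propositional.Properties using (∈-++⁺ˡ; ∈-++⁺ʳ; ∈-++⁻; ∈-map⁺; ∈-map⁻; ∈-∃++; ∈-allFin)
open import Data.Product using (Σ; _×_; _,_; proj₁; proj₂; uncurry)
open import Data.Sum using (_⊎_; inj₁; inj₂; swap; map₂)
import Data.Sum as Sum
open import Data.Empty using (⊥; ⊥-elim)
open import Function using (_∘_; id)
open import Function.Bundles using (Equivalence)
open import Relation.Nullary using (¬_; Dec; yes; no)
open import Relation.Unary using (Decidable)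
open import Relation.Binary.PropositionalEquality using (_≡_; _≢_; refl; sym; trans; cong; cong₂; subst; subst₂; module ≡-Reasoning)

module _ {A B : Set} (f : A → B) where

  InjectiveOn : List A → Set
  InjectiveOn xs = ∀ {x y} → x ∈ xs → y ∈ xs → f x ≡ f y → x ≡ y

  Unique-map⁺ : ∀ {xs} → InjectiveOn xs → Unique xs → Unique (map f xs)
  Unique-map⁺ {[]} inj u = []
  Unique-map⁺ {x ∷ xs} inj (x∉ ∷ u) =
    All.tabulate (λ fy∈ fx≡fy → let y , y∈xs , fy≡ = ∈-map⁻ f fy∈ in
                   All.lookup x∉ y∈xs (inj (here refl) (there y∈xs) (trans fx≡fy fy≡)))
    ∷ Unique-map⁺ (λ x∈ y∈ → inj (there x∈) (there y∈)) u

  Unique-map⇒InjectiveOn : ∀ {xs} → Unique (map f xs) → InjectiveOn xs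
  Unique-map⇒InjectiveOn {x ∷ xs} u (here refl) (here refl) fx≡fy = refl
  Unique-map⇒InjectiveOn {x ∷ xs} (fx∉ ∷ _) (here refl) (there y∈) fx≡fy =
    ⊥-elim (All.lookup fx∉ (∈-map⁺ f y∈) fx≡fy)
  Unique-map⇒InjectiveOn {x ∷ xs} (fx∉ ∷ _) (there x∈) (here refl) fx≡fy =
    ⊥-elim (All.lookup fx∉ (∈-map⁺ f x∈) (sym fx≡fy))
  Unique-map⇒InjectiveOn {x ∷ xs} (_ ∷ u) (there x∈) (there y∈) fx≡fy =
    Unique-map⇒InjectiveOn u x∈ y∈ fx≡fy

InjectiveOn-∘ : ∀ {A B C : Set} {g : B → C} {f : A → B} {xs} →
  InjectiveOn g (map f xs) → InjectiveOn f xs → InjectiveOn (g ∘ f) xs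
InjectiveOn-∘ {f = f} inj-g inj-f x∈ y∈ e = inj-f x∈ y∈ (inj-g (∈-map⁺ f x∈) (∈-map⁺ f y∈) e)

module _ {A : Set} where

  loop : A → List A → List A
  loop v xs = v ∷ xs ++ v ∷ []

  ∈-loop⁻ : ∀ {a v : A} xs → a ∈ loop v xs → a ≡ v ⊎ a ∈ xs
  ∈-loop⁻ xs (here refl) = inj₁ refl
  ∈-loop⁻ xs (there a∈) with ∈-++⁻ xs a∈
  ... | inj₁ a∈xs = inj₂ a∈xs
  ... | inj₂ (here refl) = inj₁ refl

  ∈-∷ʳ⁻ : ∀ {a y : A} xs → a ∈ xs ++ y ∷ [] → a ≢ y → a ∈ xs
  ∈-∷ʳ⁻ xs a∈ a≢y with ∈-++⁻ xs a∈
  ... | inj₁ a∈xs = a∈xs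
  ... | inj₂ (here a≡y) = ⊥-elim (a≢y a≡y)

  ∷-initLast : ∀ (x : A) xs → Σ (List A) λ ys → Σ A λ y → x ∷ xs ≡ ys ++ y ∷ []
  ∷-initLast x [] = [] , x , refl
  ∷-initLast x (x′ ∷ xs) = let ys , y , eq = ∷-initLast x′ xs in x ∷ ys , y , cong (x ∷_) eq

  ∈-loop⇒∈ : ∀ {a v : A} xs → a ∈ loop v xs → a ∈ v ∷ xs
  ∈-loop⇒∈ xs a∈ with ∈-loop⁻ xs a∈
  ... | inj₁ refl = here refl
  ... | inj₂ a∈xs = there a∈xs

  consecutive-++-∷ : ∀ xs (y : A) zs →
    consecutive (xs ++ y ∷ zs) ≡ consecutive (xs ++ y ∷ []) ++ consecutive (y ∷ zs)
  consecutive-++-∷ [] y zs = refl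
  consecutive-++-∷ (x ∷ []) y zs = refl
  consecutive-++-∷ (x ∷ x′ ∷ xs) y zs = cong ((x , x′) ∷_) (consecutive-++-∷ (x′ ∷ xs) y zs)

  consecutive-loop-++-∷ : ∀ (v : A) xs z ys →
    consecutive (loop v (xs ++ z ∷ ys)) ≡ consecutive (v ∷ xs ++ z ∷ []) ++ consecutive (z ∷ ys ++ v ∷ [])
  consecutive-loop-++-∷ v xs z ys =
    trans (cong (λ l → consecutive (v ∷ l)) (++-assoc xs (z ∷ ys) (v ∷ [])))
          (consecutive-++-∷ (v ∷ xs) z (ys ++ v ∷ []))

  map-proj₁-consecutive : ∀ xs (y : A) → map proj₁ (consecutive (xs ++ y ∷ [])) ≡ xs
  map-proj₁-consecutive [] y = refl
  map-proj₁-consecutive (x ∷ []) y = refl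
  map-proj₁-consecutive (x ∷ x′ ∷ xs) y = cong (x ∷_) (map-proj₁-consecutive (x′ ∷ xs) y)

  map-proj₂-consecutive : ∀ (x : A) ys → map proj₂ (consecutive (x ∷ ys)) ≡ ys
  map-proj₂-consecutive x [] = refl
  map-proj₂-consecutive x (y ∷ ys) = cong (y ∷_) (map-proj₂-consecutive y ys)

  length-consecutive : ∀ (x : A) ys → length (consecutive (x ∷ ys)) ≡ length ys
  length-consecutive x ys =
    trans (sym (length-map proj₂ (consecutive (x ∷ ys)))) (cong length (map-proj₂-consecutive x ys))

  ∈-consecutive⁻ : ∀ {a b : A} xs → (a , b) ∈ consecutive xs → a ∈ xs × b ∈ xs
  ∈-consecutive⁻ (x ∷ y ∷ xs) (here refl) = here refl , there (here refl)
  ∈-consecutive⁻ (x ∷ y ∷ xs) (there ab∈) =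
    let a∈ , b∈ = ∈-consecutive⁻ (y ∷ xs) ab∈ in there a∈ , there b∈

  consecutive-∷⁺ : ∀ (x : A) ys → consecutive ys ⊆ consecutive (x ∷ ys)
  consecutive-∷⁺ x (y ∷ z ∷ ys) p∈ = there p∈

  consecutive-++⁺ : ∀ (xs ys : List A) → consecutive xs ⊆ consecutive (xs ++ ys)
  consecutive-++⁺ (x ∷ y ∷ xs) ys (here refl) = here refl
  consecutive-++⁺ (x ∷ y ∷ xs) ys (there p∈) = there (consecutive-++⁺ (y ∷ xs) ys p∈)

  consecutive-head : ∀ (a : A) ys b → Σ A λ c → (a , c) ∈ consecutive (a ∷ ys ++ b ∷ [])
  consecutive-head a [] b = b , here refl
  consecutive-head a (y ∷ ys) b = y , here refl

  consecutive-last : ∀ xs (y b : A) → (y , b) ∈ consecutive (xs ++ y ∷ b ∷ [])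
  consecutive-last [] y b = here refl
  consecutive-last (x ∷ []) y b = there (here refl)
  consecutive-last (x ∷ x′ ∷ xs) y b = there (consecutive-last (x′ ∷ xs) y b)

  All-along-consecutive : ∀ {P : A → Set} x xs →
    (∀ {a b} → (a , b) ∈ consecutive (x ∷ xs) → P a → P b) → P x → All P (x ∷ xs)
  All-along-consecutive x [] step px = px ∷ []
  All-along-consecutive x (y ∷ xs) step px =
    px ∷ All-along-consecutive y xs (step ∘ there) (step (here refl) px)

  split-at-first : ∀ {P : A → Set} → Decidable P → ∀ {xs} → Any P xs →
    Σ (List A) λ ys → Σ A λ z → Σ (List A) λ zs → xs ≡ ys ++ z ∷ zs × All (¬_ ∘ P) ys × P z
  split-at-first P? {x ∷ xs} any with P? x
  ... | yes px = [] , x , xs , refl , [] , px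
  ... | no ¬px with any
  ...   | here px = ⊥-elim (¬px px)
  ...   | there any′ = let ys , z , zs , eq , ¬ps , pz = split-at-first P? any′ in
                       x ∷ ys , z , zs , cong (x ∷_) eq , ¬px ∷ ¬ps , pz

  Unique-++⁻ˡ : ∀ xs {ys : List A} → Unique (xs ++ ys) → Unique xs
  Unique-++⁻ˡ [] u = []
  Unique-++⁻ˡ (x ∷ xs) u@(_ ∷ u′) =
    All.¬Any⇒All¬ xs (Unique[x∷xs]⇒x∉xs u ∘ ∈-++⁺ˡ) ∷ Unique-++⁻ˡ xs u′

  Unique-++⁻ʳ : ∀ xs {ys : List A} → Unique (xs ++ ys) → Unique ys
  Unique-++⁻ʳ [] u = u
  Unique-++⁻ʳ (x ∷ xs) (_ ∷ u) = Unique-++⁻ʳ xs u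

  Unique-++⇒Disjoint : ∀ xs {ys : List A} → Unique (xs ++ ys) → Disjoint xs ys
  Unique-++⇒Disjoint (x ∷ xs) u (here refl , x∈ys) = Unique[x∷xs]⇒x∉xs u (∈-++⁺ʳ xs x∈ys)
  Unique-++⇒Disjoint (x ∷ xs) (_ ∷ u) (there z∈xs , z∈ys) = Unique-++⇒Disjoint xs u (z∈xs , z∈ys)

  Unique-rotate : ∀ xs (ys : List A) → Unique (xs ++ ys) → Unique (ys ++ xs)
  Unique-rotate xs ys u =
    ++⁺ (Unique-++⁻ʳ xs u) (Unique-++⁻ˡ xs u) (λ (z∈ys , z∈xs) → Unique-++⇒Disjoint xs u (z∈xs , z∈ys))

  loop-tail-injective : ∀ {v : A} {xs} → Unique (v ∷ xs) → InjectiveOn proj₁ (consecutive (loop v xs))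
  loop-tail-injective {v} {xs} u = Unique-map⇒InjectiveOn proj₁
    (subst Unique (sym (map-proj₁-consecutive (v ∷ xs) v)) u)

  loop-head-injective : ∀ {v : A} {xs} → Unique (v ∷ xs) → InjectiveOn proj₂ (consecutive (loop v xs))
  loop-head-injective {v} {xs} u = Unique-map⇒InjectiveOn proj₂
    (subst Unique (sym (map-proj₂-consecutive v (xs ++ v ∷ []))) (Unique-rotate (v ∷ []) xs u))

  reroot : ∀ s r {v : A} → v ∈ s ∷ r → Unique (s ∷ r) →
    Σ (List A) λ xs → Unique (v ∷ xs) ×
      consecutive (loop s r) ⊆ consecutive (loop v xs) × consecutive (loop v xs) ⊆ consecutive (loop s r)
  reroot s r {v} v∈ u with ∈-∃++ v∈
  ... | [] , xs , refl = xs , u , id , id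
  ... | a ∷ as , bs , refl = bs ++ a ∷ as , Unique-rotate (a ∷ as) (v ∷ bs) u ,
      subst₂ _⊆_ (sym (consecutive-loop-++-∷ a as v bs)) (sym (consecutive-loop-++-∷ v bs a as))
        (⊆-reflexive-↭ (++-comm (consecutive (a ∷ as ++ v ∷ [])) _)) ,
      subst₂ _⊆_ (sym (consecutive-loop-++-∷ v bs a as)) (sym (consecutive-loop-++-∷ a as v bs))
        (⊆-reflexive-↭ (++-comm (consecutive (v ∷ bs ++ a ∷ [])) _))

  private
    ∈-remove : ∀ xs {x z : A} {ys} → z ∈ xs ++ x ∷ ys → z ≢ x → z ∈ xs ++ ys
    ∈-remove [] (here refl) z≢x = ⊥-elim (z≢x refl)
    ∈-remove [] (there z∈) z≢x = z∈
    ∈-remove (y ∷ xs) (here refl) z≢x = here refl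
    ∈-remove (y ∷ xs) (there z∈) z≢x = there (∈-remove xs z∈ z≢x)

  Unique⇒length≤ : ∀ {xs ys : List A} → Unique xs → xs ⊆ ys → length xs ≤ length ys
  Unique⇒length≤ {[]} u xs⊆ys = z≤n
  Unique⇒length≤ {x ∷ xs} {ys} u@(_ ∷ u′) xs⊆ys with ∈-∃++ (xs⊆ys (here refl))
  ... | ys₁ , ys₂ , refl =
    subst (suc (length xs) ≤_) (sym (trans (length-++ ys₁) (+-suc (length ys₁) (length ys₂))))
      (s≤s (subst (length xs ≤_) (length-++ ys₁)
        (Unique⇒length≤ u′ λ z∈xs →
          ∈-remove ys₁ (xs⊆ys (there z∈xs)) λ { refl → Unique[x∷xs]⇒x∉xs u z∈xs })))

Unique⇒length≤card : ∀ {k} {xs : List (Fin k)} → Unique xs → length xs ≤ k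
Unique⇒length≤card {k} {xs} u =
  subst (length xs ≤_) (length-tabulate (λ i → i)) (Unique⇒length≤ u (λ {z} _ → ∈-allFin z))

card≤length : ∀ {k} {xs : List (Fin k)} → (∀ z → z ∈ xs) → k ≤ length xs
card≤length {k} {xs} covers =
  subst (_≤ length xs) (length-tabulate (λ i → i)) (Unique⇒length≤ (allFin⁺ k) (λ {z} _ → covers z))

Twins : {A : Set} → A → A → A → A → Set
Twins a b x y = (x ≡ a × y ≡ b) ⊎ (x ≡ b × y ≡ a)

module _ {k : ℕ} {a b : Fin (suc k)} (a≢b : a ≢ b) where

  private
    image : ∀ x → Dec (x ≡ b) → Fin k
    image x (yes _) = punchOut (a≢b ∘ sym)
    image x (no x≢b) = punchOut (x≢b ∘ sym)

    image-≡ : ∀ x y dx dy → image x dx ≡ image y dy → x ≡ y ⊎ Twins a b x y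
    image-≡ x y (yes refl) (yes refl) e = inj₁ refl
    image-≡ x y (yes refl) (no y≢b) e = inj₂ (inj₂ (refl , sym (punchOut-injective (a≢b ∘ sym) (y≢b ∘ sym) e)))
    image-≡ x y (no x≢b) (yes refl) e = inj₂ (inj₁ (punchOut-injective (x≢b ∘ sym) (a≢b ∘ sym) e , refl))
    image-≡ x y (no x≢b) (no y≢b) e = inj₁ (punchOut-injective (x≢b ∘ sym) (y≢b ∘ sym) e)

  identify : Fin (suc k) → Fin k
  identify x = image x (x ≟ b)

  identify-≡ : ∀ {x y} → identify x ≡ identify y → x ≡ y ⊎ Twins a b x y
  identify-≡ {x} {y} = image-≡ x y (x ≟ b) (y ≟ b)

  identify-≡-separate : ∀ {x y} → y ≢ a → y ≢ b → identify x ≡ identify y → x ≡ y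
  identify-≡-separate y≢a y≢b e with identify-≡ e
  ... | inj₁ x≡y = x≡y
  ... | inj₂ (inj₁ (_ , y≡b)) = ⊥-elim (y≢b y≡b)
  ... | inj₂ (inj₂ (_ , y≡a)) = ⊥-elim (y≢a y≡a)

  identify-injectiveOn : ∀ {xs} → ¬ (a ∈ xs × b ∈ xs) → InjectiveOn identify xs
  identify-injectiveOn ¬both x∈ y∈ e with identify-≡ e
  ... | inj₁ x≡y = x≡y
  ... | inj₂ (inj₁ (refl , refl)) = ⊥-elim (¬both (x∈ , y∈))
  ... | inj₂ (inj₂ (refl , refl)) = ⊥-elim (¬both (y∈ , x∈))

module _ {n : ℕ} (G : Digraph n) where

  SoleInNeighbour : Fin n → Fin n → Set
  SoleInNeighbour v a = ∀ {p} → Arc G p a → p ≡ v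

  SoleOutNeighbour : Fin n → Fin n → Set
  SoleOutNeighbour v a = ∀ {q} → Arc G a q → q ≡ v

  module _ {x y : Fin n} (P : Path G x y) where

    open Path P using (internal; distinct)

    path-arc : ∀ {a b} → (a , b) ∈ pathArcs G P → Arc G a b
    path-arc = All.lookup (Path.walk P)

    internal-unique : Unique internal
    internal-unique = Unique-++⁻ˡ internal (Unique-++⁻ʳ (x ∷ []) distinct)

    path-tails : map proj₁ (pathArcs G P) ≡ x ∷ internal
    path-tails = map-proj₁-consecutive (x ∷ internal) y

    path-heads : map proj₂ (pathArcs G P) ≡ internal ++ y ∷ []
    path-heads = map-proj₂-consecutive x (internal ++ y ∷ [])

    path-length : length (pathArcs G P) ≡ suc (length internal)
    path-length = trans (length-consecutive x (internal ++ y ∷ []))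
                        (trans (length-++ internal) (+-comm (length internal) 1))

    path-tails-unique : Unique (map proj₁ (pathArcs G P))
    path-tails-unique = subst Unique (sym path-tails) (Unique-++⁻ˡ (x ∷ internal) distinct)

    path-arc-tail-injective : InjectiveOn proj₁ (pathArcs G P)
    path-arc-tail-injective = Unique-map⇒InjectiveOn proj₁ path-tails-unique

    path-arc-head-injective : InjectiveOn proj₂ (pathArcs G P)
    path-arc-head-injective = Unique-map⇒InjectiveOn proj₂
      (subst Unique (sym path-heads) (Unique-++⁻ʳ (x ∷ []) distinct))

    path-arcs-unique : Unique (pathArcs G P)
    path-arcs-unique = map⁻ path-tails-unique

    path-head≢start : ∀ {a b} → (a , b) ∈ pathArcs G P → b ≢ x
    path-head≢start ab∈ refl =
      Unique[x∷xs]⇒x∉xs distinct (subst (x ∈_) path-heads (∈-map⁺ proj₂ ab∈))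

    path-successor : ∀ {a} → a ∈ x ∷ internal → Σ (Fin n) λ b → (a , b) ∈ pathArcs G P
    path-successor {a} a∈ with ∈-map⁻ proj₁ (subst (a ∈_) (sym path-tails) a∈)
    ... | (_ , b) , ab∈ , refl = b , ab∈

    path-predecessor : ∀ {b} → b ∈ internal → Σ (Fin n) λ a → (a , b) ∈ pathArcs G P
    path-predecessor {b} b∈ with ∈-map⁻ proj₂ (subst (b ∈_) (sym path-heads) (∈-++⁺ˡ b∈))
    ... | (a , _) , ab∈ , refl = a , ab∈

    -- a simple path leaves v at most once
    in-twins-internal : ∀ {v a b} → SoleInNeighbour v a → SoleInNeighbour v b →
                        a ∈ internal → b ∈ internal → a ≡ b
    in-twins-internal a-in b-in a∈ b∈ with path-predecessor a∈ | path-predecessor b∈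
    ... | p , pa∈ | q , qb∈ with a-in (path-arc pa∈) | b-in (path-arc qb∈)
    ... | refl | refl = cong proj₂ (path-arc-tail-injective pa∈ qb∈ refl)

    out-twins-nonfinal : ∀ {v a b} → SoleOutNeighbour v a → SoleOutNeighbour v b →
                         a ∈ x ∷ internal → b ∈ x ∷ internal → a ≡ b
    out-twins-nonfinal a-out b-out a∈ b∈ with path-successor a∈ | path-successor b∈
    ... | p , ap∈ | q , bq∈ with a-out (path-arc ap∈) | b-out (path-arc bq∈)
    ... | refl | refl = cong proj₁ (path-arc-head-injective ap∈ bq∈ refl)

    forced-successor-on-path : ∀ {a b} → a ∈ pathVertices G P → a ≢ y → SoleOutNeighbour b a →
                               b ∈ pathVertices G P
    forced-successor-on-path a∈ a≢y b-out with path-successor (∈-∷ʳ⁻ (x ∷ internal) a∈ a≢y)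
    ... | q , aq∈ = subst (_∈ pathVertices G P) (b-out (path-arc aq∈))
                          (proj₂ (∈-consecutive⁻ (pathVertices G P) aq∈))

module _ {m : ℕ} (G : Digraph (suc (suc m))) {x y : Fin (suc (suc m))} (x≢y : x ≢ y)
         (spanning : ∀ (P : Path G x y) z → z ∈ pathVertices G P) where

  private
    internal-length : ∀ (P : Path G x y) → m ≤ length (Path.internal P)
    internal-length P = s≤s⁻¹ (s≤s⁻¹ (subst (suc (suc m) ≤_)
      (cong suc (trans (length-++ (Path.internal P)) (+-comm _ 1))) (card≤length (spanning P))))

  RVColouring⇒≥ : ∀ {k} → RVColouring G k → m ≤ k
  RVColouring⇒≥ (c , rainbow) with rainbow x y x≢y
  ... | P , c-unique = ≤-trans (internal-length P)
    (subst (_≤ _) (length-map c (Path.internal P)) (Unique⇒length≤card c-unique))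

  TRColouring⇒≥ : ∀ {k} → TRColouring G k → m + suc m ≤ k
  TRColouring⇒≥ {k} (cv , ca , rainbow) with rainbow x y x≢y
  ... | P , c-unique = begin
    m + suc m                             ≡⟨ +-comm m (suc m) ⟩
    suc m + m                             ≤⟨ +-mono-≤ (s≤s (internal-length P)) (internal-length P) ⟩
    suc (length I) + length I             ≡⟨ cong₂ _+_ (sym (trans (length-map _ (pathArcs G P)) (path-length G P)))
                                                        (sym (length-map cv I)) ⟩
    length arcColours + length (map cv I) ≡⟨ sym (length-++ arcColours) ⟩
    length (arcColours ++ map cv I)       ≤⟨ Unique⇒length≤card c-unique ⟩
    k                                     ∎
    where
    open ≤-Reasoning
    I = Path.internal P
    arcColours = map (uncurry ca) (pathArcs G P)

↑ʳ≢↑ˡ : ∀ {m k} (i : Fin k) (j : Fin m) → m ↑ʳ i ≢ j ↑ˡ k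
↑ʳ≢↑ˡ {m} {k} i j e with trans (sym (splitAt-↑ʳ m k i)) (trans (cong (splitAt m) e) (splitAt-↑ˡ m j k))
... | ()

module TwinColouring {m : ℕ} (G : Digraph (suc (suc m))) (connected : StronglyConnected G)
  {s t a b a′ b′ : Fin (suc (suc m))}
  (a-in : SoleInNeighbour G s a) (b-in : SoleInNeighbour G s b)
  (a′-out : SoleOutNeighbour G t a′) (b′-out : SoleOutNeighbour G t b′)
  (a≢b : a ≢ b) (a′≢b′ : a′ ≢ b′) (a′≢a : a′ ≢ a) (a′≢b : a′ ≢ b) (b′≢a : b′ ≢ a) (b′≢b : b′ ≢ b)
  where

  private
    merge-ab : Fin (suc (suc m)) → Fin (suc m)
    merge-ab = identify a≢b

    merged-a′≢b′ : merge-ab a′ ≢ merge-ab b′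
    merged-a′≢b′ e = a′≢b′ (identify-≡-separate a≢b b′≢a b′≢b e)

    merged-∈⁻ : ∀ {z xs} → z ≢ a → z ≢ b → merge-ab z ∈ map merge-ab xs → z ∈ xs
    merged-∈⁻ z≢a z≢b z∈ with ∈-map⁻ merge-ab z∈
    ... | w , w∈ , e = subst (_∈ _) (identify-≡-separate a≢b z≢a z≢b (sym e)) w∈

  vertexColour : Fin (suc (suc m)) → Fin m
  vertexColour = identify merged-a′≢b′ ∘ merge-ab

  arcColour : Fin (suc (suc m)) → Fin (suc (suc m)) → Fin (suc m)
  arcColour p q = identify a′≢b′ p

  module _ {x y} (P : Path G x y) where

    open Path P using (internal)

    vertexColour-injective : InjectiveOn vertexColour internal
    vertexColour-injective = InjectiveOn-∘
      (identify-injectiveOn merged-a′≢b′ λ (a′∈ , b′∈) →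
         a′≢b′ (out-twins-nonfinal G P a′-out b′-out
                  (there (merged-∈⁻ a′≢a a′≢b a′∈)) (there (merged-∈⁻ b′≢a b′≢b b′∈))))
      (identify-injectiveOn a≢b λ (a∈ , b∈) → a≢b (in-twins-internal G P a-in b-in a∈ b∈))

    -- only arcs leaving a′ and b′ share a colour, and both enter t
    arcColour-injective : InjectiveOn (uncurry arcColour) (pathArcs G P)
    arcColour-injective p∈ q∈ e with identify-≡ a′≢b′ e
    ... | inj₁ same-tail = path-arc-tail-injective G P p∈ q∈ same-tail
    ... | inj₂ (inj₁ (refl , refl)) = path-arc-head-injective G P p∈ q∈
          (trans (a′-out (path-arc G P p∈)) (sym (b′-out (path-arc G P q∈))))
    ... | inj₂ (inj₂ (refl , refl)) = path-arc-head-injective G P p∈ q∈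
          (trans (b′-out (path-arc G P p∈)) (sym (a′-out (path-arc G P q∈))))

  rvColouring : RVColouring G m
  rvColouring = vertexColour , λ x y x≢y → let P = connected x y x≢y in
    P , Unique-map⁺ vertexColour (vertexColour-injective P) (internal-unique G P)

  trColouring : TRColouring G (m + suc m)
  trColouring = cv , ca , λ x y x≢y → let P = connected x y x≢y in
    P , ++⁺ (Unique-map⁺ (uncurry ca)
               (λ p∈ q∈ e → arcColour-injective P p∈ q∈ (↑ʳ-injective m _ _ e)) (path-arcs-unique G P))
            (Unique-map⁺ cv (λ a∈ b∈ e → vertexColour-injective P a∈ b∈ (↑ˡ-injective (suc m) _ _ e))
               (internal-unique G P))
            (λ (c∈arcs , c∈vertices) → palettes-disjoint c∈arcs c∈vertices)
    where
    cv : Fin (suc (suc m)) → Fin (m + suc m)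
    cv z = vertexColour z ↑ˡ suc m
    ca : Fin (suc (suc m)) → Fin (suc (suc m)) → Fin (m + suc m)
    ca p q = m ↑ʳ arcColour p q
    palettes-disjoint : ∀ {c arcs vertices} → c ∈ map (uncurry ca) arcs → c ∈ map cv vertices → ⊥
    palettes-disjoint c∈arcs c∈vertices with ∈-map⁻ (uncurry ca) c∈arcs | ∈-map⁻ cv c∈vertices
    ... | (p , q) , _ , refl | z , _ , e = ↑ʳ≢↑ˡ (arcColour p q) (vertexColour z) e

record Bouquet {n : ℕ} (G : Digraph n) : Set where
  field
    centre : Fin n
    u₁ u′ w₁ w′ : Fin n
    Uₘ Wₘ : List (Fin n)

  U : List (Fin n)
  U = u₁ ∷ Uₘ ++ u′ ∷ []

  W : List (Fin n)
  W = w₁ ∷ Wₘ ++ w′ ∷ []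

  field
    U-unique : Unique (centre ∷ U)
    W-unique : Unique (centre ∷ W)
    U#W : Disjoint U W
    arc-on-cycle : ∀ {a b} → Arc G a b →
      (a , b) ∈ consecutive (loop centre U) ⊎ (a , b) ∈ consecutive (loop centre W)

mirror : ∀ {n} {G : Digraph n} → Bouquet G → Bouquet G
mirror B = record
  { centre = centre ; u₁ = w₁ ; u′ = w′ ; w₁ = u₁ ; w′ = u′ ; Uₘ = Wₘ ; Wₘ = Uₘ
  ; U-unique = W-unique ; W-unique = U-unique ; U#W = λ (z∈W , z∈U) → U#W (z∈U , z∈W)
  ; arc-on-cycle = swap ∘ arc-on-cycle }
  where open Bouquet B

bouquet-size : ∀ {n} {G : Digraph n} → Bouquet G → 2 ≤ n
bouquet-size B = ≤-trans (s≤s (s≤s z≤n)) (Unique⇒length≤card (Bouquet.U-unique B))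

module _ {n : ℕ} {G : Digraph n} (B : Bouquet G) where

  open Bouquet B

  private
    ∈U⇒∉loop-W : ∀ {a} → a ∈ U → a ∈ loop centre W → ⊥
    ∈U⇒∉loop-W a∈U a∈ with ∈-loop⁻ W a∈
    ... | inj₁ refl = Unique[x∷xs]⇒x∉xs U-unique a∈U
    ... | inj₂ a∈W = U#W (a∈U , a∈W)

  u₁-in : SoleInNeighbour G centre u₁
  u₁-in arc with arc-on-cycle arc
  ... | inj₁ pu₁∈ = cong proj₁ (loop-head-injective U-unique pu₁∈ (here refl) refl)
  ... | inj₂ pu₁∈ = ⊥-elim (∈U⇒∉loop-W (here refl) (proj₂ (∈-consecutive⁻ (loop centre W) pu₁∈)))

  U-out : ∀ {a b} → (a , b) ∈ consecutive (U ++ centre ∷ []) → SoleOutNeighbour G b a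
  U-out {a} ab∈ arc with arc-on-cycle arc
  ... | inj₁ aq∈ =
    cong proj₂ (loop-tail-injective U-unique aq∈ (consecutive-∷⁺ centre (U ++ centre ∷ []) ab∈) refl)
  ... | inj₂ aq∈ = ⊥-elim (∈U⇒∉loop-W
          (subst (a ∈_) (map-proj₁-consecutive U centre) (∈-map⁺ proj₁ ab∈))
          (proj₁ (∈-consecutive⁻ (loop centre W) aq∈)))

  u′-out : SoleOutNeighbour G centre u′
  u′-out = U-out (subst (λ l → (u′ , centre) ∈ consecutive (u₁ ∷ l))
                        (sym (++-assoc Uₘ (u′ ∷ []) (centre ∷ [])))
                        (consecutive-last (u₁ ∷ Uₘ) u′ centre))

  centre-out : ∀ {q} → Arc G centre q → q ≡ u₁ ⊎ q ≡ w₁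
  centre-out arc with arc-on-cycle arc
  ... | inj₁ vq∈ = inj₁ (cong proj₂ (loop-tail-injective U-unique vq∈ (here refl) refl))
  ... | inj₂ vq∈ = inj₂ (cong proj₂ (loop-tail-injective W-unique vq∈ (here refl) refl))

  u₁≢u′ : u₁ ≢ u′
  u₁≢u′ refl = Unique[x∷xs]⇒x∉xs (Unique-++⁻ʳ (centre ∷ []) U-unique) (∈-++⁺ʳ Uₘ (here refl))

  U≢W : ∀ {a b} → a ∈ U → b ∈ W → a ≢ b
  U≢W a∈U b∈W refl = U#W (a∈U , b∈W)

  u₁∈U : u₁ ∈ U
  u₁∈U = here refl

  u′∈U : u′ ∈ U
  u′∈U = there (∈-++⁺ʳ Uₘ (here refl))

module _ {m : ℕ} {G : Digraph (suc (suc m))} (connected : StronglyConnected G) (B : Bouquet G) where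

  open Bouquet B

  private
    w₁∈W : w₁ ∈ W
    w₁∈W = u₁∈U (mirror B)

    w′∈W : w′ ∈ W
    w′∈W = u′∈U (mirror B)

  vertex-on-bouquet : ∀ z → z ≡ centre ⊎ z ∈ U ⊎ z ∈ W
  vertex-on-bouquet z with z ≟ centre
  ... | yes z≡v = inj₁ z≡v
  ... | no z≢v with consecutive-head z (Path.internal (connected z centre z≢v)) centre
  ... | c , zc∈ with arc-on-cycle (path-arc G (connected z centre z≢v) zc∈)
  ... | inj₁ zc∈ = map₂ inj₁ (∈-loop⁻ U (proj₁ (∈-consecutive⁻ (loop centre U) zc∈)))
  ... | inj₂ zc∈ = map₂ inj₂ (∈-loop⁻ W (proj₁ (∈-consecutive⁻ (loop centre W) zc∈)))

  -- P is forced along U to the centre and then, as it cannot return to u₁, along W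
  module _ (P : Path G u₁ w′) where

    private
      on-P = _∈ pathVertices G P

      U-on-P : All on-P (U ++ centre ∷ [])
      U-on-P = All-along-consecutive u₁ ((Uₘ ++ u′ ∷ []) ++ centre ∷ [])
        (λ {a} ab∈ a∈ → forced-successor-on-path G P a∈
          (U≢W B (subst (a ∈_) (map-proj₁-consecutive U centre) (∈-map⁺ proj₁ ab∈)) w′∈W) (U-out B ab∈))
        (here refl)

      centre-on-P : on-P centre
      centre-on-P = All.lookup U-on-P (∈-++⁺ʳ U (here refl))

      w₁-on-P : on-P w₁
      w₁-on-P with path-successor G P (∈-∷ʳ⁻ (u₁ ∷ Path.internal P) centre-on-P
                      (λ { refl → Unique[x∷xs]⇒x∉xs W-unique w′∈W }))
      ... | q , vq∈ with centre-out B (path-arc G P vq∈)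
      ... | inj₁ refl = ⊥-elim (path-head≢start G P vq∈ refl)
      ... | inj₂ refl = proj₂ (∈-consecutive⁻ (pathVertices G P) vq∈)

      W-on-P : All on-P W
      W-on-P = All-along-consecutive w₁ (Wₘ ++ w′ ∷ [])
        (λ {a} ab∈ a∈ → forced-successor-on-path G P a∈
          (λ { refl → Unique-++⇒Disjoint (w₁ ∷ Wₘ) (Unique-++⁻ʳ (centre ∷ []) W-unique)
                        (subst (w′ ∈_) (map-proj₁-consecutive (w₁ ∷ Wₘ) w′) (∈-map⁺ proj₁ ab∈) , here refl) })
          (U-out (mirror B) (consecutive-++⁺ W (centre ∷ []) ab∈)))
        w₁-on-P

    u₁w′-path-spanning : ∀ z → z ∈ pathVertices G P
    u₁w′-path-spanning z with vertex-on-bouquet z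
    ... | inj₁ refl = centre-on-P
    ... | inj₂ (inj₁ z∈U) = All.lookup U-on-P (∈-++⁺ˡ z∈U)
    ... | inj₂ (inj₂ z∈W) = All.lookup W-on-P z∈W

  private
    module Colouring = TwinColouring G connected
      (u₁-in B) (u₁-in (mirror B)) (u′-out B) (u′-out (mirror B))
      (U≢W B (u₁∈U B) w₁∈W) (U≢W B (u′∈U B) w′∈W) (u₁≢u′ B ∘ sym) (U≢W B (u′∈U B) w₁∈W)
      (U≢W B (u₁∈U B) w′∈W ∘ sym) (u₁≢u′ (mirror B) ∘ sym)

    u₁≢w′ : u₁ ≢ w′
    u₁≢w′ = U≢W B (u₁∈U B) w′∈W

  bouquet-rvc : RVCis G m
  bouquet-rvc = Colouring.rvColouring ,
    λ j j<m c → <⇒≱ j<m (RVColouring⇒≥ G u₁≢w′ u₁w′-path-spanning c)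

  bouquet-trc : TRCis G (m + suc m)
  bouquet-trc = Colouring.trColouring ,
    λ j j<2m+1 c → <⇒≱ j<2m+1 (TRColouring⇒≥ G u₁≢w′ u₁w′-path-spanning c)

module _ {n : ℕ} {G : Digraph n} where

  cycleVertices : Cycle G → List (Fin n)
  cycleVertices C = Cycle.start C ∷ Cycle.rest C

  cycle-arc : ∀ (C : Cycle G) {a b} → InCycle G C a b → Arc G a b
  cycle-arc C = All.lookup (Cycle.closed C)

  cycle-arc-ends : ∀ (C : Cycle G) {a b} → InCycle G C a b → a ∈ cycleVertices C × b ∈ cycleVertices C
  cycle-arc-ends C ab∈ = let a∈ , b∈ = ∈-consecutive⁻ _ ab∈ in
    ∈-loop⇒∈ (Cycle.rest C) a∈ , ∈-loop⇒∈ (Cycle.rest C) b∈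

  reroot-cycle : ∀ (C : Cycle G) {v} → v ∈ cycleVertices C →
    Σ (List (Fin n)) λ xs → Unique (v ∷ xs) ×
      cycleArcs G C ⊆ consecutive (loop v xs) × consecutive (loop v xs) ⊆ cycleArcs G C
  reroot-cycle C v∈ = reroot (Cycle.start C) (Cycle.rest C) v∈ (Cycle.distinct C)

  -- no loops exclude xs = [], no opposite arcs exclude xs = [x]
  oriented-loop-shape : Oriented G → ∀ {v} xs → (∀ {a b} → (a , b) ∈ consecutive (loop v xs) → Arc G a b) →
    Σ (Fin n) λ first → Σ (List (Fin n)) λ middle → Σ (Fin n) λ last → xs ≡ first ∷ middle ++ last ∷ []
  oriented-loop-shape (no-loop , _) [] arcs = ⊥-elim (subst T (no-loop _) (arcs (here refl)))
  oriented-loop-shape (_ , no-2-cycle) (x ∷ []) arcs =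
    ⊥-elim (subst T (no-2-cycle _ x (arcs (here refl))) (arcs (there (here refl))))
  oriented-loop-shape _ (x ∷ x′ ∷ xs) arcs =
    let middle , last , x′∷xs≡ = ∷-initLast x′ xs in x , middle , last , cong (x ∷_) x′∷xs≡

  IsWalk-++-∷ : ∀ xs z ys → IsWalk G (xs ++ z ∷ []) → IsWalk G (z ∷ ys) → IsWalk G (xs ++ z ∷ ys)
  IsWalk-++-∷ xs z ys walk₁ walk₂ =
    subst (All _) (sym (consecutive-++-∷ xs z ys)) (All.++⁺ walk₁ walk₂)

  spliced-cycle : ∀ {v} xs z ys → Unique (v ∷ xs ++ z ∷ ys) →
    IsWalk G (v ∷ xs ++ z ∷ []) → IsWalk G (z ∷ ys ++ v ∷ []) → Cycle G
  spliced-cycle {v} xs z ys u walk₁ walk₂ = record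
    { start = v ; rest = xs ++ z ∷ ys ; nontriv = nontrivial xs ; distinct = u
    ; closed = subst (λ l → IsWalk G (v ∷ l)) (sym (++-assoc xs (z ∷ ys) (v ∷ [])))
                 (IsWalk-++-∷ (v ∷ xs) z (ys ++ v ∷ []) walk₁ walk₂) }
    where
    nontrivial : ∀ xs → 1 ≤ length (xs ++ z ∷ ys)
    nontrivial [] = s≤s z≤n
    nontrivial (_ ∷ _) = s≤s z≤n

module _ {n : ℕ} {G : Digraph n} (cactus : IsCactus G) (blocks : HasBlocks G 2) where

  open DecMembership (_≟_ {n}) using (_∈?_)

  private
    oriented = proj₁ cactus
    connected = proj₁ (proj₂ cactus)
    unique-cycle = proj₂ (proj₂ cactus)

    C₁ C₂ : Cycle G
    C₁ = proj₁ blocks zero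
    C₂ = proj₁ blocks (suc zero)

  arc-in-block : ∀ {a b} → Arc G a b → InCycle G C₁ a b ⊎ InCycle G C₂ a b
  arc-in-block {a} {b} arc with proj₁ (unique-cycle a b arc)
  ... | C , ab∈C with proj₂ (proj₂ blocks) C
  ... | zero , same = inj₁ (Equivalence.to (same a b) ab∈C)
  ... | suc zero , same = inj₂ (Equivalence.to (same a b) ab∈C)

  arc-in-both : ∀ {a b} → InCycle G C₁ a b → InCycle G C₂ a b → ⊥
  arc-in-both {a} {b} ab∈C₁ ab∈C₂
    with proj₁ (proj₂ blocks) zero (suc zero)
           (proj₂ (unique-cycle a b (cycle-arc C₁ ab∈C₁)) C₁ C₂ ab∈C₁ ab∈C₂)
  ... | ()

  private
    path-stays-in-C₁ : (∀ {a} → a ∈ cycleVertices C₁ → a ∉ cycleVertices C₂) →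
      ∀ {x y} (P : Path G x y) → x ∈ cycleVertices C₁ → All (_∈ cycleVertices C₁) (pathVertices G P)
    path-stays-in-C₁ only-C₁ P x∈C₁ = All-along-consecutive _ (Path.internal P ++ _ ∷ [])
      (λ ab∈ a∈C₁ → Sum.[ (λ ab∈C₁ → proj₂ (cycle-arc-ends C₁ ab∈C₁))
                        , (λ ab∈C₂ → ⊥-elim (only-C₁ a∈C₁ (proj₁ (cycle-arc-ends C₂ ab∈C₂)))) ]′
                        (arc-in-block (path-arc G P ab∈)))
      x∈C₁

  common-vertex : Σ (Fin n) λ v → v ∈ cycleVertices C₁ × v ∈ cycleVertices C₂
  common-vertex with any? (_∈? cycleVertices C₂) (cycleVertices C₁)
  ... | yes common = find common
  ... | no none = ⊥-elim (none (lose s₂∈C₁ (here refl)))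
    where
    s₂∈C₁ : Cycle.start C₂ ∈ cycleVertices C₁
    s₂∈C₁ with Cycle.start C₁ ≟ Cycle.start C₂
    ... | yes s₁≡s₂ = here (sym s₁≡s₂)
    ... | no s₁≢s₂ = All.lookup (path-stays-in-C₁ (λ a∈₁ a∈₂ → none (lose a∈₁ a∈₂)) P (here refl))
                                (∈-++⁺ʳ (_ ∷ Path.internal P) (here refl))
      where P = connected (Cycle.start C₁) (Cycle.start C₂) s₁≢s₂

  -- a common vertex z of X and Y, chosen first on X, would close the cycle v → X → z → Y → v,
  -- whose arcs lie partly in C₁ and partly in C₂
  rerooted-disjoint : ∀ {v} X Y → Unique (v ∷ X) → Unique (v ∷ Y) →
    consecutive (loop v X) ⊆ cycleArcs G C₁ → consecutive (loop v Y) ⊆ cycleArcs G C₂ → Disjoint X Y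
  rerooted-disjoint {v} X Y X-unique Y-unique X⊆C₁ Y⊆C₂ (z∈X , z∈Y)
    with split-at-first (_∈? Y) (lose z∈X z∈Y)
  ... | X₁ , z , X₂ , refl , X₁∉Y , z∈Y′ with ∈-∃++ z∈Y′
  ... | Y₁ , Y₂ , refl =
    arc-in-both (Equivalence.to (N≡C₁ _ _) (N-arcs (∈-++⁺ʳ _ zd∈))) (Y⊆C₂ (Y-half zd∈))
    where
    X-half : consecutive (v ∷ X₁ ++ z ∷ []) ⊆ consecutive (loop v X)
    X-half p∈ = subst (_ ∈_) (sym (consecutive-loop-++-∷ v X₁ z X₂)) (∈-++⁺ˡ p∈)

    Y-half : consecutive (z ∷ Y₂ ++ v ∷ []) ⊆ consecutive (loop v Y)
    Y-half p∈ = subst (_ ∈_) (sym (consecutive-loop-++-∷ v Y₁ z Y₂)) (∈-++⁺ʳ _ p∈)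

    N-unique : Unique (v ∷ X₁ ++ z ∷ Y₂)
    N-unique = All.¬Any⇒All¬ _
      (λ v∈ → Sum.[ Unique[x∷xs]⇒x∉xs X-unique ∘ ∈-++⁺ˡ , Unique[x∷xs]⇒x∉xs Y-unique ∘ ∈-++⁺ʳ Y₁ ]′
                  (∈-++⁻ X₁ v∈))
      ∷ (++⁺ (Unique-++⁻ˡ X₁ (Unique-++⁻ʳ (v ∷ []) X-unique)) (Unique-++⁻ʳ (v ∷ Y₁) Y-unique)
           (λ (a∈X₁ , a∈zY₂) → All.lookup X₁∉Y a∈X₁ (∈-++⁺ʳ Y₁ a∈zY₂)))

    N : Cycle G
    N = spliced-cycle X₁ z Y₂ N-unique
      (All.tabulate (cycle-arc C₁ ∘ X⊆C₁ ∘ X-half)) (All.tabulate (cycle-arc C₂ ∘ Y⊆C₂ ∘ Y-half))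

    N-arcs : consecutive (v ∷ X₁ ++ z ∷ []) ++ consecutive (z ∷ Y₂ ++ v ∷ []) ⊆ cycleArcs G N
    N-arcs p∈ = subst (_ ∈_) (sym (consecutive-loop-++-∷ v X₁ z Y₂)) p∈

    vc∈ = proj₂ (consecutive-head v X₁ z)
    zd∈ = proj₂ (consecutive-head z Y₂ v)

    N≡C₁ : SameCycle G N C₁
    N≡C₁ = proj₂ (unique-cycle v _ (cycle-arc C₁ (X⊆C₁ (X-half vc∈))))
             N C₁ (N-arcs (∈-++⁺ˡ vc∈)) (X⊆C₁ (X-half vc∈))

  cactus⇒bouquet : Bouquet G
  cactus⇒bouquet with common-vertex
  ... | v , v∈C₁ , v∈C₂ with reroot-cycle C₁ v∈C₁ | reroot-cycle C₂ v∈C₂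
  ... | X , X-unique , C₁⊆X , X⊆C₁ | Y , Y-unique , C₂⊆Y , Y⊆C₂
    with oriented-loop-shape oriented X (cycle-arc C₁ ∘ X⊆C₁)
       | oriented-loop-shape oriented Y (cycle-arc C₂ ∘ Y⊆C₂)
  ... | u₁ , Uₘ , u′ , refl | w₁ , Wₘ , w′ , refl = record
    { centre = v ; u₁ = u₁ ; u′ = u′ ; w₁ = w₁ ; w′ = w′ ; Uₘ = Uₘ ; Wₘ = Wₘ
    ; U-unique = X-unique ; W-unique = Y-unique
    ; U#W = rerooted-disjoint X Y X-unique Y-unique X⊆C₁ Y⊆C₂
    ; arc-on-cycle = Sum.map C₁⊆X C₂⊆Y ∘ arc-in-block }

2[2+m]∸3≡m+[1+m] : ∀ m → 2 * suc (suc m) ∸ 3 ≡ m + suc m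
2[2+m]∸3≡m+[1+m] m = begin
  2 * suc (suc m) ∸ 3        ≡⟨⟩
  m + suc (suc (m + 0)) ∸ 1  ≡⟨ cong (_∸ 1) (+-suc m (suc (m + 0))) ⟩
  m + suc (m + 0)            ≡⟨ cong (λ k → m + suc k) (+-identityʳ m) ⟩
  m + suc m                  ∎
  where open ≡-Reasoning

corollary26 : (n : ℕ) (Q : Digraph n) → IsCactus Q → HasBlocks Q 2 →
    RVCis Q (n ∸ 2) × TRCis Q (2 * n ∸ 3)
corollary26 zero Q cactus blocks with bouquet-size (cactus⇒bouquet cactus blocks)
... | ()
corollary26 (suc zero) Q cactus blocks with bouquet-size (cactus⇒bouquet cactus blocks)
... | s≤s ()
corollary26 (suc (suc m)) Q cactus blocks =
  bouquet-rvc connected B , subst (TRCis Q) (sym (2[2+m]∸3≡m+[1+m] m)) (bouquet-trc connected B)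
  where
  connected = proj₁ (proj₂ cactus)
  B = cactus⇒bouquet cactus blocks
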